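{- For every value $V$, $\overline{V:k}=V$.
   Context: Syntax. Fix a ring of scalars; $\alpha,\beta$ range over it. Terms: $M,N,L ::= V \mid MN \mid \alpha.M \mid M+N$; values $V,W ::= B \mid 0 \mid \alpha.V \mid V+W$; base values $B ::= x \mid \lambda x.M$, with $x$ ranging over an infinite set of variables. Terms are taken up to $\alpha$-conversion; application associates left and binds tighter than $+$ and $\alpha.$. CPS translation. The variables $k,b,b_1,b_2$ are reserved names distinct from all variables of source terms. $[\![x]\!]=\lambda k.kx$; $[\![\lambda x.M]\!]=\lambda k.k(\lambda x.[\![M]\!])$; $[\![MN]\!]=\lambda k.[\![M]\!](\lambda b_1.[\![N]\!](\lambda b_2.b_1b_2k))$; $[\![0]\!]=0$; $[\![\alpha.M]\!]=\lambda k.(\alpha.[\![M]\!])k$; $[\![M+N]\!]=\lambda k.([\![M]\!]+[\![N]\!])k$. Colon translation: $\Psi(x)=x$, $\Psi(\lambda x.M)=\lambda x.[\![M]\!]$; for a base value $B$, $B:K = K\,\Psi(B)$; $0:K=0$; $\alpha.M:K=\alpha.(M:K)$; $(M+N):K=(M:K)+(N:K)$ (further clauses for applications are not needed for values). CPS grammar. Base computations $C ::= KB \mid B_1B_2K \mid TK$; computation combinations $D ::= C \mid 0 \mid \alpha.D \mid D_1+D_2$; base suspensions $S ::= \lambda k.C$; suspension combinations $T ::= S \mid 0\mid \alpha.T \mid T_1+T_2$; continuations $K ::= k \mid \lambda b.BbK \mid \lambda b_1.T(\lambda b_2.b_1b_2K)$; CPS-values $B ::= x \mid \lambda x.S$ ($x$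 an ordinary variable). The reserved variable $k$ occurs only as the continuation $k$ and as the binder in $\lambda k.C$; $b,b_1,b_2$ occur only where displayed. Inverse translation: $\overline{KB}=\underline{K}[\psi(B)]$; $\overline{B_1B_2K}=\underline{K}[\psi(B_1)\psi(B_2)]$; $\overline{TK}=\underline{K}[\sigma(T)]$; $\overline{0}=0$; $\overline{\alpha.D}=\alpha.\overline{D}$; $\overline{D_1+D_2}=\overline{D_1}+\overline{D_2}$; $\sigma(\lambda k.C)=\overline{C}$; $\sigma(0)=0$; $\sigma(\alpha.T)=\alpha.\sigma(T)$; $\sigma(T_1+T_2)=\sigma(T_1)+\sigma(T_2)$; $\psi(x)=x$; $\psi(\lambda x.S)=\lambda x.\sigma(S)$; $\underline{k}[M]=M$; $\underline{\lambda b.BbK}[M]=\underline{K}[\psi(B)M]$; $\underline{\lambda b_1.T(\lambda b_2.b_1b_2K)}[M]=\underline{K}[M\,\sigma(T)]$. -}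

module Defs where

open import Level using (Level)
open import Data.Nat using (ℕ)

-- Variables are natural numbers; binders are named, and all translations
-- below keep binder names unchanged, so no α-conversion is ever needed and
-- syntactic equality is the right notion of equality for the statement.
-- The reserved CPS variables k, b, b₁, b₂ are not variables here but are
-- built into the constructors of the CPS grammar (hence automatically
-- distinct from source variables and occurring only where displayed).

module Lang {a : Level} (Scalar : Set a) where

  Var : Set
  Var = ℕ

  data Term : Set a where
    var  : Var → Term
    lam  : Var → Term → Term
    app  : Term → Term → Term
    zero : Term
    sc   : Scalar → Term → Term
    plus : Term → Term → Term

  data BaseVal : Set a where
    var : Var → BaseVal
    lam : Var → Term → BaseVal

  data Val : Set a where
    base : BaseVal → Val
    zero : Val
    sc   : Scalar → Val → Val
    plus : Val → Val → Val

  ⌜_⌝ᵇ : BaseVal → Term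
  ⌜ var x ⌝ᵇ = var x
  ⌜ lam x M ⌝ᵇ = lam x M

  ⌜_⌝ : Val → Term
  ⌜ base B ⌝ = ⌜ B ⌝ᵇ
  ⌜ zero ⌝ = zero
  ⌜ sc α V ⌝ = sc α ⌜ V ⌝
  ⌜ plus V W ⌝ = plus ⌜ V ⌝ ⌜ W ⌝

  mutual
    data Comp : Set a where
      kapp : Cont → CVal → Comp
      bapp : CVal → CVal → Cont → Comp
      tapp : SuspC → Cont → Comp

    data CompC : Set a where
      base : Comp → CompC
      zero : CompC
      sc   : Scalar → CompC → CompC
      plus : CompC → CompC → CompC

    data Susp : Set a where
      lamk : Comp → Susp

    data SuspC : Set a where
      base : Susp → SuspC
      zero : SuspC
      sc   : Scalar → SuspC → SuspC
      plus : SuspC → SuspC → SuspC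

    data Cont : Set a where
      k    : Cont
      lamb  : CVal → Cont → Cont                -- λb.B b K
      lamb₁ : SuspC → Cont → Cont               -- λb₁.T(λb₂.b₁ b₂ K)

    -- CPS-values  B ::= x | λx.T   (body generalised from S to T
    -- so that Ψ(λx.0) = λx.[[0]] = λx.0 is in the grammar)
    data CVal : Set a where
      var : Var → CVal
      lam : Var → SuspC → CVal

  ⟦_⟧ : Term → SuspC
  ⟦ var x ⟧ = base (lamk (kapp k (var x)))
  ⟦ lam x M ⟧ = base (lamk (kapp k (lam x ⟦ M ⟧)))
  ⟦ app M N ⟧ = base (lamk (tapp ⟦ M ⟧ (lamb₁ ⟦ N ⟧ k)))
  ⟦ zero ⟧ = zero
  ⟦ sc α M ⟧ = base (lamk (tapp (sc α ⟦ M ⟧) k))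
  ⟦ plus M N ⟧ = base (lamk (tapp (plus ⟦ M ⟧ ⟦ N ⟧) k))

  Ψ : BaseVal → CVal
  Ψ (var x) = var x
  Ψ (lam x M) = lam x ⟦ M ⟧

  _∶_ : Val → Cont → CompC
  base B ∶ K = base (kapp K (Ψ B))
  zero ∶ K = zero
  sc α V ∶ K = sc α (V ∶ K)
  plus V W ∶ K = plus (V ∶ K) (W ∶ K)

  mutual
    ‾_ : Comp → Term
    ‾ kapp K B = under K [ ψ B ]
    ‾ bapp B₁ B₂ K = under K [ app (ψ B₁) (ψ B₂) ]
    ‾ tapp T K = under K [ σ T ]

    ‾ᴰ_ : CompC → Term
    ‾ᴰ base C = ‾ C
    ‾ᴰ zero = zero
    ‾ᴰ sc α D = sc α (‾ᴰ D)
    ‾ᴰ plus D₁ D₂ = plus (‾ᴰ D₁) (‾ᴰ D₂)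

    σˢ : Susp → Term
    σˢ (lamk C) = ‾ C

    σ : SuspC → Term
    σ (base S) = σˢ S
    σ zero = zero
    σ (sc α T) = sc α (σ T)
    σ (plus T₁ T₂) = plus (σ T₁) (σ T₂)

    ψ : CVal → Term
    ψ (var x) = var x
    ψ (lam x T) = lam x (σ T)

    under_[_] : Cont → Term → Term
    under k [ M ] = M
    under lamb B K [ M ] = under K [ app (ψ B) M ]
    under lamb₁ T K [ M ] = under K [ app M (σ T) ]

module Submission where

-- 1. σ is a left inverse of the CPS translation: σ ⟦ M ⟧ ≡ M for every
--    term M (induction on M; each clause of ⟦_⟧ wraps the translation of
--    the subterms in a suspension λk.C whose continuation is k or one of
--    the administrative continuations, all of which σ peels off again).
-- 2. Consequently ψ inverts Ψ on base values: ψ (Ψ B) ≡ B.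
-- 3. For values, V ∶ k distributes over 0, α. and +, and a base value B
--    becomes k Ψ(B), whose inverse is ψ (Ψ B); induction on V with step 2
--    gives ‾ (V ∶ k) ≡ V.

open import Defs
open import Algebra.Bundles using (Ring)
open import Relation.Binary.PropositionalEquality using (_≡_; refl; cong; cong₂)

module ColonInverse {a} (Scalar : Set a) where
  open Lang Scalar

  σ-⟦⟧ : (M : Term) → σ ⟦ M ⟧ ≡ M
  σ-⟦⟧ (var x)    = refl
  σ-⟦⟧ (lam x M)  = cong (lam x) (σ-⟦⟧ M)
  σ-⟦⟧ (app M N)  = cong₂ app (σ-⟦⟧ M) (σ-⟦⟧ N)
  σ-⟦⟧ zero       = refl
  σ-⟦⟧ (sc α M)   = cong (sc α) (σ-⟦⟧ M)
  σ-⟦⟧ (plus M N) = cong₂ plus (σ-⟦⟧ M) (σ-⟦⟧ N)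

  ψ-Ψ : (B : BaseVal) → ψ (Ψ B) ≡ ⌜ B ⌝ᵇ
  ψ-Ψ (var x)   = refl
  ψ-Ψ (lam x M) = cong (lam x) (σ-⟦⟧ M)

  ‾-∶k : (V : Val) → ‾ᴰ (V ∶ k) ≡ ⌜ V ⌝
  ‾-∶k (base B)   = ψ-Ψ B
  ‾-∶k zero       = refl
  ‾-∶k (sc α V)   = cong (sc α) (‾-∶k V)
  ‾-∶k (plus V W) = cong₂ plus (‾-∶k V) (‾-∶k W)

lemma3p6 : ∀ {c ℓ} (R : Ring c ℓ) (V : Lang.Val (Ring.Carrier R)) →
           Lang.‾ᴰ_ (Ring.Carrier R) (Lang._∶_ (Ring.Carrier R) V (Lang.k))
             ≡ Lang.⌜_⌝ (Ring.Carrier R) V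
lemma3p6 R = ColonInverse.‾-∶k (Ring.Carrier R)
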